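{- For a $\lambda$-fold $1$-packing $C$ in $H(n,q)$, $q>2$, with distance distribution $(A_0,A_1,\ldots,A_n)$, it holds \[ n(q-1)A_0 + 2(q-1)A_1+2A_2 \le (n+1)(q-1)\lambda - q+1. \] Moreover, if $q$, $n$, and $\lambda$ are even, then \[ n(q-1)A_0 + 2(q-1)A_1+2A_2 \le (n+1)(q-1)\lambda-q. \] In particular, if one of the relations above holds with equality, then $A_0=1$ (that is, there are no codewords of $C$ with multiplicity more than one) and $A_1=\lambda-1$.
   Context: $H(n,q)$ is the Hamming graph on the $n$-words over the alphabet $\{0,1,\ldots,q-1\}$, two words being adjacent if they differ in exactly one position; $d(\cdot,\cdot)$ denotes the Hamming distance. A $\lambda$-fold $1$-packing in $H(n,q)$ is a multiset $C$ of vertices such that the radius-$1$ balls centered at the words of $C$ cover each vertex of $H(n,q)$ not more than $\lambda$ times. The distance distribution of $C$ is $(A_i)_{i=0}^n$, where $A_i:=\frac{1}{|C|}\sum_{\mathbf{x}\in C}A_i(\mathbf{x})$ and $A_i(\mathbf{x}):=|\{\mathbf{y}\in C:\ d(\mathbf{x},\mathbf{y})=i\}|$ (counted with multiplicity). -}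

module Defs where

open import Data.Nat using (ℕ; _+_; _*_; _≤_)
open import Data.Nat.Properties using (_≟_)
open import Data.Fin using (Fin)
open import Data.Fin.Properties as FinP using ()
open import Data.List using (List; length; filter; map; allFin)
open import Data.Nat.ListAction using (sum)
open import Relation.Nullary using (¬?)

Word : ℕ → ℕ → Set
Word n q = Fin n → Fin q

dist : ∀ {n q} → Word n q → Word n q → ℕ
dist {n} x y = length (filter (λ i → ¬? (x i FinP.≟ y i)) (allFin n))

-- A code (multiset of words) is represented by a list (multiplicity = number of occurrences).
-- Number of codewords (with multiplicity) whose radius-1 ball contains v.
coverCount : ∀ {n q} → List (Word n q) → Word n q → ℕ
coverCount C v = length (filter (λ c → Data.Nat._≤?_ (dist c v) 1) C)
  where import Data.Nat

IsPacking : ∀ {n q} → ℕ → List (Word n q) → Set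
IsPacking {n} {q} lam C = (v : Word n q) → coverCount C v ≤ lam

Aᵢ : ∀ {n q} → List (Word n q) → ℕ → Word n q → ℕ
Aᵢ C i x = length (filter (λ y → dist x y ≟ i) C)

-- |C| * A_i  =  Σ_{x ∈ C} A_i(x)   (total, un-normalised distance distribution).
totA : ∀ {n q} → List (Word n q) → ℕ → ℕ
totA C i = sum (map (Aᵢ C i) C)

-- Fix a codeword x and count the pairs (c, v) with c ∈ C and v in both radius-one balls B(x) and
-- B(c). Each v ∈ B(x) lies in at most λ balls, so there are at most λ |B(x)| = λ (1 + n(q-1))
-- such pairs, while |B(x) ∩ B(c)| is 1 + n(q-1), q or 2 when d(x,c) is 0, 1 or 2. Together with
-- A₀(x) ≥ 1 and A₀(x) + A₁(x) ≤ λ (all these codewords cover x) this gives the inequality for the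
-- single codeword x, with slack (q-1)(A₀(x) - 1) + (q-2)(λ - A₀(x) - A₁(x)) + s, where s ≥ 0 is the
-- slack of the pair count. Summing over C gives the first bound, and equality forces every
-- codeword slack to vanish, i.e. A₀(x) = 1 and A₁(x) = λ - 1. If q, n and λ are even, a parity
-- count shows that each codeword slack is odd, hence at least 1; since then q ≥ 4, a slack of
-- exactly 1 still forces A₀(x) = 1 and A₁(x) = λ - 1.
module Submission where

open import Level using (Level)
open import Function using (_∘_; _$_; const; id)
open import Data.Nat using (ℕ; zero; suc; _+_; _*_; _∸_; _≤_; _<_; _≤?_; z≤n; s≤s)
open import Data.Nat.Properties
  using (_≟_; +-assoc; +-comm; +-suc; +-identityʳ; *-suc; *-zeroʳ; *-identityʳ; *-distribˡ-+;
         ≤-trans; ≤-reflexive; ≤-antisym; ≤⇒≯; n≤1+n; m≤m+n; m≤n⇒m≤1+n; m≤n⇒∃[o]m+o≡n;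
         +-mono-≤; +-monoˡ-≤; +-monoʳ-≤; +-cancelˡ-≤; +-cancelʳ-≤; +-cancelˡ-≡; m+[n∸m]≡n;
         m+n≡0⇒m≡0; m+n≡0⇒n≡0; +-commutativeSemigroup; module ≤-Reasoning)
open import Algebra.Properties.CommutativeSemigroup +-commutativeSemigroup using (interchange; x∙yz≈y∙xz)
open import Data.Nat.Divisibility using (_∣_; ∣1⇒≡1; ∣m+n∣m⇒∣n; ∣m⇒∣m*n; ∣n⇒∣m*n; ∣m∣n⇒∣m+n; ∣-refl)
open import Data.Nat.ListAction using (sum)
open import Data.Nat.Tactic.RingSolver using (solve-∀)
open import Data.Fin using (Fin; punchIn; punchOut)
import Data.Fin.Properties as Finₚ
open import Data.Vec.Functional using (updateAt)
open import Data.Vec.Functional.Properties using (updateAt-updates; updateAt-minimal)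
open import Data.List using (List; []; _∷_; length; filter; map; allFin; concat; concatMap)
open import Data.List.Properties
  using (filter-++; filter-≐; filter-all; filter-none; filter-accept;
         length-++; length-++-≤ˡ; length-++-≤ʳ; length-map; length-tabulate)
open import Data.List.Membership.Propositional using (_∈_; _∉_)
open import Data.List.Membership.Propositional.Properties
  using (∈-filter⁺; ∈-filter⁻; ∈-length; ∈-allFin; ∈-map⁺; ∈-map⁻; ∈-concat⁺′; ∈-concat⁻′)
open import Data.List.Relation.Unary.Any using (here; there)
open import Data.List.Relation.Unary.All as All using (All; []; _∷_)
open import Data.List.Relation.Unary.AllPairs using (_∷_)
open import Data.List.Relation.Unary.Unique.Propositional using (Unique)
import Data.List.Relation.Unary.Unique.Propositional.Properties as Unique
open import Data.Product using (∃; ∃₂; _×_; _,_; proj₁; proj₂)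
open import Data.Sum using (_⊎_; inj₁; inj₂)
open import Relation.Nullary using (¬_; ¬?; yes; no; contradiction)
open import Relation.Nullary.Decidable using (decidable-stable)
open import Relation.Unary using (Pred; Decidable; _⊆_; _∪_; _⊥_)
open import Relation.Binary.Core using (REL)
import Relation.Binary.Definitions as Binary
open import Relation.Binary.PropositionalEquality
  using (_≡_; _≢_; _≗_; refl; sym; trans; cong; cong₂; subst; subst₂; module ≡-Reasoning)

open import Defs

private
  variable
    a b p q r : Level
    A : Set a
    B : Set b

sum-map-+ : (f g : A → ℕ) (xs : List A) →
            sum (map (λ x → f x + g x) xs) ≡ sum (map f xs) + sum (map g xs)
sum-map-+ f g [] = refl
sum-map-+ f g (x ∷ xs) = trans (cong (f x + g x +_) (sum-map-+ f g xs))
                               (interchange (f x) (g x) (sum (map f xs)) (sum (map g xs)))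

sum-map-*ˡ : (k : ℕ) (f : A → ℕ) (xs : List A) → sum (map (λ x → k * f x) xs) ≡ k * sum (map f xs)
sum-map-*ˡ k f [] = sym (*-zeroʳ k)
sum-map-*ˡ k f (x ∷ xs) = trans (cong (k * f x +_) (sum-map-*ˡ k f xs)) (sym (*-distribˡ-+ k (f x) _))

sum-map-const : {f : A → ℕ} {c : ℕ} {xs : List A} → All (λ x → f x ≡ c) xs → sum (map f xs) ≡ length xs * c
sum-map-const [] = refl
sum-map-const (fx≡c ∷ fxs≡c) = cong₂ _+_ fx≡c (sum-map-const fxs≡c)

sum-map-1 : (xs : List A) → sum (map (λ _ → 1) xs) ≡ length xs
sum-map-1 [] = refl
sum-map-1 (_ ∷ xs) = cong suc (sum-map-1 xs)

sum-map-mono : {f g : A → ℕ} {xs : List A} → All (λ x → f x ≤ g x) xs → sum (map f xs) ≤ sum (map g xs)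
sum-map-mono [] = z≤n
sum-map-mono (fx≤gx ∷ fxs≤gxs) = +-mono-≤ fx≤gx (sum-map-mono fxs≤gxs)

sum-map-≡0 : {f : A → ℕ} (xs : List A) → sum (map f xs) ≡ 0 → All (λ x → f x ≡ 0) xs
sum-map-≡0 [] _ = []
sum-map-≡0 {f = f} (x ∷ xs) Σ≡0 = m+n≡0⇒m≡0 (f x) Σ≡0 ∷ sum-map-≡0 xs (m+n≡0⇒n≡0 (f x) Σ≡0)

sum-map-tight : {f g : A → ℕ} {xs : List A} → All (λ x → g x ≤ f x) xs → sum (map f xs) ≤ sum (map g xs) →
                All (λ x → f x ≡ g x) xs
sum-map-tight [] _ = []
sum-map-tight {f = f} {g} {x ∷ xs} (gx≤fx ∷ gxs≤fxs) Σf≤Σg = ≤-antisym fx≤gx gx≤fx ∷ sum-map-tight gxs≤fxs Σfxs≤Σgxs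
  where
  fx≤gx : f x ≤ g x
  fx≤gx = +-cancelʳ-≤ _ _ _ (≤-trans Σf≤Σg (+-monoʳ-≤ (g x) (sum-map-mono gxs≤fxs)))
  Σfxs≤Σgxs : sum (map f xs) ≤ sum (map g xs)
  Σfxs≤Σgxs = +-cancelˡ-≤ _ _ _ (≤-trans Σf≤Σg (+-monoˡ-≤ _ gx≤fx))

module _ {P : Pred A p} (P? : Decidable P) where

  length-filter-concat-≥ : {xs : List A} {xss : List (List A)} → xs ∈ xss →
                           length (filter P? xs) ≤ length (filter P? (concat xss))
  length-filter-concat-≥ {xss = xs ∷ xss} (here refl)
    rewrite filter-++ P? xs (concat xss) = length-++-≤ˡ (filter P? xs) {filter P? (concat xss)}
  length-filter-concat-≥ {xss = ys ∷ xss} (there xs∈xss)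
    rewrite filter-++ P? ys (concat xss) =
      ≤-trans (length-filter-concat-≥ xs∈xss) (length-++-≤ʳ (filter P? (concat xss)) {filter P? ys})

module _ {P : Pred A p} {Q : Pred A q} {R : Pred A r} (P? : Decidable P) (Q? : Decidable Q) (R? : Decidable R)
         (P⊥Q : P ⊥ Q) (P∪Q⊆R : P ∪ Q ⊆ R) where

  length-filter-∪-≤ : ∀ xs → length (filter P? xs) + length (filter Q? xs) ≤ length (filter R? xs)
  length-filter-∪-≤ [] = z≤n
  length-filter-∪-≤ (x ∷ xs) with ih ← length-filter-∪-≤ xs | P? x | Q? x | R? x
  ... | yes px | yes qx | _      = contradiction (px , qx) P⊥Q
  ... | yes px | no _   | no ¬rx = contradiction (P∪Q⊆R (inj₁ px)) ¬rx
  ... | no _   | yes qx | no ¬rx = contradiction (P∪Q⊆R (inj₂ qx)) ¬rx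
  ... | yes _  | no _   | yes _  = s≤s ih
  ... | no _   | yes _  | yes _  = subst (_≤ suc (length (filter R? xs)))
                                        (sym (+-suc (length (filter P? xs)) (length (filter Q? xs)))) (s≤s ih)
  ... | no _   | no _   | yes _  = m≤n⇒m≤1+n ih
  ... | no _   | no _   | no _   = ih

distinct-∈⇒2≤length : {x y : A} {xs : List A} → x ≢ y → x ∈ xs → y ∈ xs → 2 ≤ length xs
distinct-∈⇒2≤length {xs = _ ∷ _ ∷ _} _ _ _ = s≤s (s≤s z≤n)
distinct-∈⇒2≤length {xs = _ ∷ []} x≢y (here refl) (here refl) = contradiction refl x≢y

Unique∧All≡⇒length≤1 : {x : A} {xs : List A} → Unique xs → All (_≡ x) xs → length xs ≤ 1
Unique∧All≡⇒length≤1 {xs = []} _ _ = z≤n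
Unique∧All≡⇒length≤1 {xs = _ ∷ []} _ _ = s≤s z≤n
Unique∧All≡⇒length≤1 ((y≢z ∷ _) ∷ _) (refl ∷ refl ∷ _) = contradiction refl y≢z

length-concatMap-const : {f : A → List B} {k : ℕ} (xs : List A) → (∀ x → length (f x) ≡ k) →
                         length (concatMap f xs) ≡ length xs * k
length-concatMap-const [] _ = refl
length-concatMap-const {f = f} (x ∷ xs) |f|≡k =
  trans (length-++ (f x)) (cong₂ _+_ (|f|≡k x) (length-concatMap-const xs |f|≡k))

module _ {R : REL A B r} (R? : Binary.Decidable R) where

  private
    degree : List A → B → ℕ
    degree xs y = length (filter (λ x → R? x y) xs)

    degree-∷ : ∀ x xs ys → sum (map (degree (x ∷ xs)) ys) ≡ length (filter (R? x) ys) + sum (map (degree xs) ys)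

    degree-∷-rearranged : ∀ x xs y ys → degree xs y + sum (map (degree (x ∷ xs)) ys)
                                        ≡ length (filter (R? x) ys) + (degree xs y + sum (map (degree xs) ys))

    degree-∷ x xs [] = refl
    degree-∷ x xs (y ∷ ys) with R? x y
    ... | yes _ = cong suc (degree-∷-rearranged x xs y ys)
    ... | no _  = degree-∷-rearranged x xs y ys

    degree-∷-rearranged x xs y ys = trans (cong (degree xs y +_) (degree-∷ x xs ys))
                                        (x∙yz≈y∙xz (degree xs y) (length (filter (R? x) ys)) (sum (map (degree xs) ys)))

  double-counting : ∀ xs ys → sum (map (λ y → length (filter (λ x → R? x y) xs)) ys)
                              ≡ sum (map (λ x → length (filter (R? x) ys)) xs)
  double-counting [] ys = trans (sum-map-const (All.universal (λ _ → refl) ys)) (*-zeroʳ (length ys))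
  double-counting (x ∷ xs) ys = trans (degree-∷ x xs ys) (cong (length (filter (R? x) ys) +_) (double-counting xs ys))

module _ {n q : ℕ} where

  differingPositions : Word n q → Word n q → List (Fin n)
  differingPositions x y = filter (λ i → ¬? (x i Finₚ.≟ y i)) (allFin n)

  module _ {x y : Word n q} where

    ≢⇒∈differingPositions : ∀ {k} → x k ≢ y k → k ∈ differingPositions x y
    ≢⇒∈differingPositions {k} = ∈-filter⁺ (λ i → ¬? (x i Finₚ.≟ y i)) (∈-allFin k)

    ∈differingPositions⇒≢ : ∀ {k} → k ∈ differingPositions x y → x k ≢ y k
    ∈differingPositions⇒≢ k∈ = proj₂ (∈-filter⁻ (λ i → ¬? (x i Finₚ.≟ y i)) {xs = allFin n} k∈)

    ∉differingPositions⇒≡ : ∀ {k} → k ∉ differingPositions x y → x k ≡ y k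
    ∉differingPositions⇒≡ {k} k∉ = decidable-stable (x k Finₚ.≟ y k) (k∉ ∘ ≢⇒∈differingPositions)

    differingPositions-unique : Unique (differingPositions x y)
    differingPositions-unique = Unique.filter⁺ (λ i → ¬? (x i Finₚ.≟ y i)) (Unique.allFin⁺ n)

  dist-sym : (x y : Word n q) → dist x y ≡ dist y x
  dist-sym x y = cong length (filter-≐ (λ i → ¬? (x i Finₚ.≟ y i)) (λ i → ¬? (y i Finₚ.≟ x i))
                                      ((λ ne → ne ∘ sym) , (λ ne → ne ∘ sym)) (allFin n))

  dist-congˡ : {x x′ : Word n q} (y : Word n q) → x ≗ x′ → dist x y ≡ dist x′ y
  dist-congˡ {x} {x′} y x≗x′ = cong length (filter-≐ (λ i → ¬? (x i Finₚ.≟ y i)) (λ i → ¬? (x′ i Finₚ.≟ y i))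
      ((λ ne → ne ∘ trans (x≗x′ _)) , (λ ne → ne ∘ trans (sym (x≗x′ _)))) (allFin n))

  ≗⇒dist≡0 : {x y : Word n q} → x ≗ y → dist x y ≡ 0
  ≗⇒dist≡0 {x} {y} x≗y = cong length (filter-none (λ i → ¬? (x i Finₚ.≟ y i)) (All.universal (λ k ne → ne (x≗y k)) (allFin n)))

  dist≡0⇒≗ : {x y : Word n q} → dist x y ≡ 0 → x ≗ y
  dist≡0⇒≗ d≡0 k = ∉differingPositions⇒≡ λ k∈ → contradiction (subst (0 <_) d≡0 (∈-length k∈)) λ ()

  agree-off⇒dist≤1 : {x y : Word n q} (i : Fin n) → (∀ k → k ≢ i → x k ≡ y k) → dist x y ≤ 1
  agree-off⇒dist≤1 {x} {y} i agree = Unique∧All≡⇒length≤1 differingPositions-unique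
    (All.tabulate λ {k} k∈ → decidable-stable (k Finₚ.≟ i) λ k≢i → ∈differingPositions⇒≢ k∈ (agree k k≢i))

  dist≡1⇒agree-off : {x y : Word n q} → dist x y ≡ 1 → ∃ λ i → ∀ k → k ≢ i → x k ≡ y k
  dist≡1⇒agree-off {x} {y} d≡1 with differingPositions x y | ∉differingPositions⇒≡ {x} {y}
  ... | i ∷ [] | agree = i , λ k k≢i → agree λ { (here k≡i) → k≢i k≡i }

  dist≡2⇒agree-off : {x y : Word n q} → dist x y ≡ 2 →
    ∃₂ λ i j → i ≢ j × x i ≢ y i × x j ≢ y j × (∀ k → k ≢ i → k ≢ j → x k ≡ y k)
  dist≡2⇒agree-off {x} {y} d≡2
    with differingPositions x y | ∉differingPositions⇒≡ {x} {y} | ∈differingPositions⇒≢ {x} {y}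
       | differingPositions-unique {x} {y}
  ... | i ∷ j ∷ [] | agree | differ | (i≢j ∷ []) ∷ _ =
    i , j , i≢j , differ (here refl) , differ (there (here refl)) ,
    λ k k≢i k≢j → agree λ { (here k≡i) → k≢i k≡i ; (there (here k≡j)) → k≢j k≡j }

-- Radius-one balls

module _ {n m : ℕ} where

  neighboursAt : Word n (suc m) → Fin n → List (Word n (suc m))
  neighboursAt x i = map (λ a → updateAt x i (const (punchIn (x i) a))) (allFin m)

  ball : Word n (suc m) → List (Word n (suc m))
  ball x = x ∷ concatMap (neighboursAt x) (allFin n)

  length-neighboursAt : ∀ x i → length (neighboursAt x i) ≡ m
  length-neighboursAt x i = trans (length-map _ (allFin m)) (length-tabulate {n = m} id)

  length-ball : ∀ x → length (ball x) ≡ suc (n * m)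
  length-ball x = cong suc (trans (length-concatMap-const (allFin n) (length-neighboursAt x))
                                    (cong (_* m) (length-tabulate {n = n} id)))

  ∈-neighboursAt⁺ : ∀ {x i a} → a ≢ x i → updateAt x i (const a) ∈ neighboursAt x i
  ∈-neighboursAt⁺ {x} {i} a≢xi =
    subst (λ b → updateAt x i (const b) ∈ neighboursAt x i) (Finₚ.punchIn-punchOut (a≢xi ∘ sym))
          (∈-map⁺ _ (∈-allFin (punchOut (a≢xi ∘ sym))))

  ∈-neighboursAt⇒agree-off : ∀ {x i v} → v ∈ neighboursAt x i → ∀ k → k ≢ i → x k ≡ v k
  ∈-neighboursAt⇒agree-off {x} {i} v∈ k k≢i with ∈-map⁻ _ v∈
  ... | a , _ , refl = sym (updateAt-minimal k i x k≢i)

  ∈-concatMap-neighbours⁻ : ∀ {x v} → v ∈ concatMap (neighboursAt x) (allFin n) → ∃ λ i → v ∈ neighboursAt x i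
  ∈-concatMap-neighbours⁻ {x} v∈ with ∈-concat⁻′ (map (neighboursAt x) (allFin n)) v∈
  ... | vs , v∈vs , vs∈ with ∈-map⁻ (neighboursAt x) vs∈
  ... | i , _ , refl = i , v∈vs

  ∈-ball⇒dist≤1 : ∀ {x v} → v ∈ ball x → dist x v ≤ 1
  ∈-ball⇒dist≤1 {x} (here refl) = subst (_≤ 1) (sym (≗⇒dist≡0 {x = x} (λ _ → refl))) z≤n
  ∈-ball⇒dist≤1 (there v∈) with ∈-concatMap-neighbours⁻ v∈
  ... | i , v∈xᵢ = agree-off⇒dist≤1 i (∈-neighboursAt⇒agree-off v∈xᵢ)

  module _ (x c : Word n (suc m)) where

    ball-∩-dist≡0 : dist x c ≡ 0 → length (filter (λ v → dist c v ≤? 1) (ball x)) ≡ suc (n * m)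
    ball-∩-dist≡0 d≡0 = trans (cong length (filter-all (λ v → dist c v ≤? 1) (All.tabulate near))) (length-ball x)
      where
      near : ∀ {v} → v ∈ ball x → dist c v ≤ 1
      near {v} v∈ = subst (_≤ 1) (dist-congˡ v (dist≡0⇒≗ d≡0)) (∈-ball⇒dist≤1 v∈)

    ball-∩-dist≡1 : dist x c ≡ 1 → suc m ≤ length (filter (λ v → dist c v ≤? 1) (ball x))
    ball-∩-dist≡1 d≡1 with i , agree ← dist≡1⇒agree-off d≡1
      rewrite filter-accept (λ v → dist c v ≤? 1) {xs = concatMap (neighboursAt x) (allFin n)}
                (subst (_≤ 1) (dist-sym x c) (≤-reflexive d≡1))
      = s≤s (begin
        m
          ≡⟨ length-neighboursAt x i ⟨
        length (neighboursAt x i)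
          ≡⟨ cong length (filter-all (λ v → dist c v ≤? 1) (All.tabulate near)) ⟨
        length (filter (λ v → dist c v ≤? 1) (neighboursAt x i))
          ≤⟨ length-filter-concat-≥ (λ v → dist c v ≤? 1) (∈-map⁺ (neighboursAt x) (∈-allFin i)) ⟩
        length (filter (λ v → dist c v ≤? 1) (concatMap (neighboursAt x) (allFin n))) ∎)
      where
      open ≤-Reasoning
      near : ∀ {v} → v ∈ neighboursAt x i → dist c v ≤ 1
      near v∈ = agree-off⇒dist≤1 i λ k k≢i → trans (sym (agree k k≢i)) (∈-neighboursAt⇒agree-off v∈ k k≢i)

    ball-∩-dist≡2 : dist x c ≡ 2 → 2 ≤ length (filter (λ v → dist c v ≤? 1) (ball x))
    ball-∩-dist≡2 d≡2 with i , j , i≢j , xi≢ci , xj≢cj , agree ← dist≡2⇒agree-off d≡2 =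
      distinct-∈⇒2≤length toward-i≢toward-j
        (∈-filter⁺ (λ v → dist c v ≤? 1) (∈-ball i xi≢ci) (near i j agree))
        (∈-filter⁺ (λ v → dist c v ≤? 1) (∈-ball j xj≢cj) (near j i λ k k≢j k≢i → agree k k≢i k≢j))
      where
      toward : Fin n → Word n (suc m)
      toward i = updateAt x i (const (c i))
      ∈-ball : ∀ i → x i ≢ c i → toward i ∈ ball x
      ∈-ball i xi≢ci = there (∈-concat⁺′ (∈-neighboursAt⁺ (xi≢ci ∘ sym)) (∈-map⁺ (neighboursAt x) (∈-allFin i)))
      near : ∀ i j → (∀ k → k ≢ i → k ≢ j → x k ≡ c k) → dist c (toward i) ≤ 1
      near i j agree = agree-off⇒dist≤1 j agree′
        where
        agree′ : ∀ k → k ≢ j → c k ≡ toward i k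
        agree′ k k≢j with k Finₚ.≟ i
        ... | yes refl = sym (updateAt-updates i x)
        ... | no k≢i   = trans (sym (agree k k≢i k≢j)) (sym (updateAt-minimal k i x k≢i))
      toward-i≢toward-j : toward i ≢ toward j
      toward-i≢toward-j eq = xi≢ci (sym (begin
        c i           ≡⟨ updateAt-updates i x ⟨
        toward i i    ≡⟨ cong (_$ i) eq ⟩
        toward j i    ≡⟨ updateAt-minimal i j x i≢j ⟩
        x i           ∎))
        where open ≡-Reasoning

-- |B(x) ∩ B(c)| for words x, c at distance d in H(n, m + 1).
ballIntersection : ℕ → ℕ → ℕ → ℕ
ballIntersection n m 0 = suc (n * m)
ballIntersection n m 1 = suc m
ballIntersection n m 2 = 2
ballIntersection n m (suc (suc (suc _))) = 0

ballIntersection-≤ : ∀ {n m} (x c : Word n (suc m)) →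
  ballIntersection n m (dist x c) ≤ length (filter (λ v → dist c v ≤? 1) (ball x))
ballIntersection-≤ x c with dist x c in d≡
... | 0 = ≤-reflexive (sym (ball-∩-dist≡0 x c d≡))
... | 1 = ball-∩-dist≡1 x c d≡
... | 2 = ball-∩-dist≡2 x c d≡
... | suc (suc (suc _)) = z≤n

sum-ballIntersection : ∀ {n m} (x : Word n (suc m)) (D : List (Word n (suc m))) →
  sum (map (λ c → ballIntersection n m (dist x c)) D) ≡ suc (n * m) * Aᵢ D 0 x + suc m * Aᵢ D 1 x + 2 * Aᵢ D 2 x
sum-ballIntersection {n} {m} x [] = at-[] (n * m) m
  where
  at-[] : ∀ N M → 0 ≡ suc N * 0 + suc M * 0 + 2 * 0
  at-[] = solve-∀
sum-ballIntersection {n} {m} x (c ∷ D) with dist x c | sum-ballIntersection x D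
... | 0 | ih = trans (cong (suc (n * m) +_) ih) (at-0 (n * m) m (Aᵢ D 0 x) (Aᵢ D 1 x) (Aᵢ D 2 x))
  where
  at-0 : ∀ N M a₀ a₁ a₂ → suc N + (suc N * a₀ + suc M * a₁ + 2 * a₂) ≡ suc N * suc a₀ + suc M * a₁ + 2 * a₂
  at-0 = solve-∀
... | 1 | ih = trans (cong (suc m +_) ih) (at-1 (n * m) m (Aᵢ D 0 x) (Aᵢ D 1 x) (Aᵢ D 2 x))
  where
  at-1 : ∀ N M a₀ a₁ a₂ → suc M + (suc N * a₀ + suc M * a₁ + 2 * a₂) ≡ suc N * a₀ + suc M * suc a₁ + 2 * a₂
  at-1 = solve-∀
... | 2 | ih = trans (cong (2 +_) ih) (at-2 (n * m) m (Aᵢ D 0 x) (Aᵢ D 1 x) (Aᵢ D 2 x))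
  where
  at-2 : ∀ N M a₀ a₁ a₂ → 2 + (suc N * a₀ + suc M * a₁ + 2 * a₂) ≡ suc N * a₀ + suc M * a₁ + 2 * suc a₂
  at-2 = solve-∀
... | suc (suc (suc _)) | ih = ih

-- A single codeword

module _ {n m : ℕ} {C : List (Word n (suc m))} (x : Word n (suc m)) where

  Aᵢ-0-≥1 : x ∈ C → 1 ≤ Aᵢ C 0 x
  Aᵢ-0-≥1 x∈C = ∈-length (∈-filter⁺ (λ y → dist x y ≟ 0) x∈C (≗⇒dist≡0 {x = x} λ _ → refl))

  Aᵢ-0+Aᵢ-1≤coverCount : Aᵢ C 0 x + Aᵢ C 1 x ≤ coverCount C x
  Aᵢ-0+Aᵢ-1≤coverCount = length-filter-∪-≤ (λ y → dist x y ≟ 0) (λ y → dist x y ≟ 1) (λ y → dist y x ≤? 1)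
    (λ (d≡0 , d≡1) → 0≢1 (trans (sym d≡0) d≡1)) covered C
    where
    0≢1 : 0 ≡ 1 → _
    0≢1 ()
    covered : ∀ {y} → dist x y ≡ 0 ⊎ dist x y ≡ 1 → dist y x ≤ 1
    covered {y} (inj₁ d≡0) = subst (_≤ 1) (trans (sym d≡0) (dist-sym x y)) z≤n
    covered {y} (inj₂ d≡1) = subst (_≤ 1) (trans (sym d≡1) (dist-sym x y)) (s≤s z≤n)

  weighted-neighbours-≤ : ∀ {lam} → IsPacking lam C →
    suc (n * m) * Aᵢ C 0 x + suc m * Aᵢ C 1 x + 2 * Aᵢ C 2 x ≤ suc (n * m) * lam
  weighted-neighbours-≤ {lam} packing = begin
    suc (n * m) * Aᵢ C 0 x + suc m * Aᵢ C 1 x + 2 * Aᵢ C 2 x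
      ≡⟨ sum-ballIntersection x C ⟨
    sum (map (λ c → ballIntersection n m (dist x c)) C)
      ≤⟨ sum-map-mono (All.universal (ballIntersection-≤ x) C) ⟩
    sum (map (λ c → length (filter (λ v → dist c v ≤? 1) (ball x))) C)
      ≡⟨ double-counting (λ c v → dist c v ≤? 1) C (ball x) ⟨
    sum (map (coverCount C) (ball x))
      ≤⟨ sum-map-mono (All.universal packing (ball x)) ⟩
    sum (map (λ _ → lam) (ball x))
      ≡⟨ sum-map-const (All.universal (λ _ → refl) (ball x)) ⟩
    length (ball x) * lam
      ≡⟨ cong (_* lam) (length-ball x) ⟩
    suc (n * m) * lam ∎
    where open ≤-Reasoning

2∤1 : ¬ 2 ∣ 1
2∤1 2∣1 with () ← ∣1⇒≡1 2∣1

slack<k⇒tight : ∀ k e a₁ s₂ s₁ → e * suc k + s₂ * k + s₁ < k → suc e ≡ 1 × a₁ + 1 ≡ suc e + a₁ + s₂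
slack<k⇒tight k zero    a₁ zero     s₁ _   = refl , trans (+-comm a₁ 1) (cong suc (sym (+-identityʳ a₁)))
slack<k⇒tight k (suc e) a₁ s₂       s₁ t<k =
  contradiction t<k (≤⇒≯ (≤-trans (n≤1+n k) (≤-trans (m≤m+n (suc k) _) (≤-trans (m≤m+n _ _) (m≤m+n _ s₁)))))
slack<k⇒tight k zero    a₁ (suc s₂) s₁ t<k = contradiction t<k (≤⇒≯ (≤-trans (m≤m+n k _) (m≤m+n _ s₁)))

-- With q = k + 2, a₀ = e + 1, lam = a₀ + a₁ + s₂ and s₁ the slack of the weighted bound,
-- the slack of the target inequality is e (q - 1) + s₂ (q - 2) + s₁.
codeword-slack : ∀ n k lam a₀ a₁ a₂ → 1 ≤ a₀ → a₀ + a₁ ≤ lam →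
  suc (n * suc k) * a₀ + suc (suc k) * a₁ + 2 * a₂ ≤ suc (n * suc k) * lam →
  ∃ λ t → (n * suc k * a₀ + 2 * suc k * a₁ + 2 * a₂ + suc k + t ≡ (n + 1) * suc k * lam)
        × (t < k → a₀ ≡ 1 × a₁ + 1 ≡ lam)
codeword-slack n k lam (suc e) a₁ a₂ (s≤s z≤n) a₀+a₁≤lam weighted
  with s₂ , refl ← m≤n⇒∃[o]m+o≡n a₀+a₁≤lam
  with s₁ , weighted≡ ← m≤n⇒∃[o]m+o≡n weighted
  = e * suc k + s₂ * k + s₁ , balance , slack<k⇒tight k e a₁ s₂ s₁
  where
  open ≡-Reasoning
  lam′ : ℕ
  lam′ = suc e + a₁ + s₂
  rearrange : ∀ n k e a₁ a₂ s₁ s₂ →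
    n * suc k * suc e + 2 * suc k * a₁ + 2 * a₂ + suc k + (e * suc k + s₂ * k + s₁)
    ≡ suc (n * suc k) * suc e + suc (suc k) * a₁ + 2 * a₂ + s₁ + k * (suc e + a₁ + s₂)
  rearrange = solve-∀
  collect : ∀ n k l → suc (n * suc k) * l + k * l ≡ (n + 1) * suc k * l
  collect = solve-∀
  balance : n * suc k * suc e + 2 * suc k * a₁ + 2 * a₂ + suc k + (e * suc k + s₂ * k + s₁)
            ≡ (n + 1) * suc k * lam′
  balance = begin
    n * suc k * suc e + 2 * suc k * a₁ + 2 * a₂ + suc k + (e * suc k + s₂ * k + s₁)
      ≡⟨ rearrange n k e a₁ a₂ s₁ s₂ ⟩
    suc (n * suc k) * suc e + suc (suc k) * a₁ + 2 * a₂ + s₁ + k * lam′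
      ≡⟨ cong (_+ k * lam′) weighted≡ ⟩
    suc (n * suc k) * lam′ + k * lam′
      ≡⟨ collect n k lam′ ⟩
    (n + 1) * suc k * lam′ ∎

slack-positive : ∀ n m lam a₀ a₁ a₂ t → 2 ∣ suc m → 2 ∣ n → 2 ∣ lam →
  n * m * a₀ + 2 * m * a₁ + 2 * a₂ + m + t ≡ (n + 1) * m * lam → 0 < t
slack-positive n m lam a₀ a₁ a₂ (suc t) _ _ _ _ = s≤s z≤n
slack-positive n m lam a₀ a₁ a₂ zero 2∣1+m 2∣n 2∣lam balance = contradiction 2∣1 2∤1
  where
  L : ℕ
  L = n * m * a₀ + 2 * m * a₁ + 2 * a₂
  2∣L : 2 ∣ L
  2∣L = ∣m∣n⇒∣m+n (∣m∣n⇒∣m+n (∣m⇒∣m*n a₀ (∣m⇒∣m*n m 2∣n)) (∣m⇒∣m*n a₁ (∣m⇒∣m*n m ∣-refl))) (∣m⇒∣m*n a₂ ∣-refl)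
  2∣L+m : 2 ∣ L + m
  2∣L+m = subst (2 ∣_) (trans (sym balance) (+-identityʳ (L + m))) (∣n⇒∣m*n ((n + 1) * m) 2∣lam)
  2∣1 : 2 ∣ 1
  2∣1 = ∣m+n∣m⇒∣n (subst (2 ∣_) (+-comm 1 m) 2∣1+m) (∣m+n∣m⇒∣n 2∣L+m 2∣L)

2∣3+r⇒0<r : ∀ r → 2 ∣ 3 + r → 0 < r
2∣3+r⇒0<r zero    2∣3 = contradiction (∣m+n∣m⇒∣n 2∣3 ∣-refl) 2∤1
2∣3+r⇒0<r (suc r) _   = s≤s z≤n

-- Summing over the code

module Slack {n k lam : ℕ} {C : List (Word n (suc (suc k)))} (packing : IsPacking lam C) where

  m : ℕ
  m = suc k

  localWeight : Word n (suc m) → ℕ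
  localWeight x = n * m * Aᵢ C 0 x + 2 * m * Aᵢ C 1 x + 2 * Aᵢ C 2 x

  slack : Word n (suc m) → ℕ
  slack x = (n + 1) * m * lam ∸ (localWeight x + m)

  private
    slack-of : ∀ {x} → x ∈ C → ∃ λ t → (localWeight x + m + t ≡ (n + 1) * m * lam)
                                     × (t < k → Aᵢ C 0 x ≡ 1 × Aᵢ C 1 x + 1 ≡ lam)
    slack-of {x} x∈C = codeword-slack n k lam (Aᵢ C 0 x) (Aᵢ C 1 x) (Aᵢ C 2 x) (Aᵢ-0-≥1 x x∈C)
      (≤-trans (Aᵢ-0+Aᵢ-1≤coverCount {C = C} x) (packing x)) (weighted-neighbours-≤ {C = C} x packing)

  slack-balance : ∀ {x} → x ∈ C → localWeight x + m + slack x ≡ (n + 1) * m * lam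
  slack-balance {x} x∈C with t , balance , _ ← slack-of x∈C =
    m+[n∸m]≡n (subst (localWeight x + m ≤_) balance (m≤m+n (localWeight x + m) t))

  slack-tight : ∀ {x} → x ∈ C → slack x < k → Aᵢ C 0 x ≡ 1 × Aᵢ C 1 x + 1 ≡ lam
  slack-tight {x} x∈C slack<k with t , balance , tight ← slack-of x∈C =
    tight (subst (_< k) (+-cancelˡ-≡ (localWeight x + m) (slack x) t (trans (slack-balance x∈C) (sym balance))) slack<k)

  slack-positive-if-even : 2 ∣ suc m → 2 ∣ n → 2 ∣ lam → ∀ {x} → x ∈ C → 0 < slack x
  slack-positive-if-even 2∣q 2∣n 2∣lam {x} x∈C =
    slack-positive n m lam (Aᵢ C 0 x) (Aᵢ C 1 x) (Aᵢ C 2 x) (slack x) 2∣q 2∣n 2∣lam (slack-balance x∈C)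

  L : ℕ
  L = n * m * totA C 0 + 2 * m * totA C 1 + 2 * totA C 2

  totalSlack : ℕ
  totalSlack = sum (map slack C)

  sum-localWeight : sum (map localWeight C) ≡ L
  sum-localWeight = begin
    sum (map localWeight C)
      ≡⟨ sum-map-+ (λ x → n * m * Aᵢ C 0 x + 2 * m * Aᵢ C 1 x) (λ x → 2 * Aᵢ C 2 x) C ⟩
    sum (map (λ x → n * m * Aᵢ C 0 x + 2 * m * Aᵢ C 1 x) C) + sum (map (λ x → 2 * Aᵢ C 2 x) C)
      ≡⟨ cong₂ _+_ (sum-map-+ (λ x → n * m * Aᵢ C 0 x) (λ x → 2 * m * Aᵢ C 1 x) C) (sum-map-*ˡ 2 (Aᵢ C 2) C) ⟩
    sum (map (λ x → n * m * Aᵢ C 0 x) C) + sum (map (λ x → 2 * m * Aᵢ C 1 x) C) + 2 * totA C 2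
      ≡⟨ cong₂ (λ a b → a + b + 2 * totA C 2) (sum-map-*ˡ (n * m) (Aᵢ C 0) C) (sum-map-*ˡ (2 * m) (Aᵢ C 1) C) ⟩
    L ∎
    where open ≡-Reasoning

  total-balance : L + length C * m + totalSlack ≡ length C * ((n + 1) * m * lam)
  total-balance = begin
    L + length C * m + totalSlack
      ≡⟨ cong₂ (λ a b → a + b + totalSlack) sum-localWeight (sum-map-const (All.universal (λ _ → refl) C)) ⟨
    sum (map localWeight C) + sum (map (λ _ → m) C) + totalSlack
      ≡⟨ cong (_+ totalSlack) (sum-map-+ localWeight (λ _ → m) C) ⟨
    sum (map (λ x → localWeight x + m) C) + totalSlack
      ≡⟨ sum-map-+ (λ x → localWeight x + m) slack C ⟨
    sum (map (λ x → localWeight x + m + slack x) C)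
      ≡⟨ sum-map-const (All.tabulate slack-balance) ⟩
    length C * ((n + 1) * m * lam) ∎
    where open ≡-Reasoning

  TotalsTight : Set
  TotalsTight = (totA C 0 ≡ length C) × (totA C 1 + length C ≡ length C * lam)

  totals-tight : All (λ x → slack x < k) C → TotalsTight
  totals-tight small = trans (sum-map-const (All.map proj₁ tight)) (*-identityʳ _) , (begin
    totA C 1 + length C
      ≡⟨ cong (totA C 1 +_) (sum-map-1 C) ⟨
    totA C 1 + sum (map (λ _ → 1) C)
      ≡⟨ sum-map-+ (Aᵢ C 1) (λ _ → 1) C ⟨
    sum (map (λ x → Aᵢ C 1 x + 1) C)
      ≡⟨ sum-map-const (All.map proj₂ tight) ⟩
    length C * lam ∎)
    where
    open ≡-Reasoning
    tight : All (λ x → Aᵢ C 0 x ≡ 1 × Aᵢ C 1 x + 1 ≡ lam) C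
    tight = All.tabulate λ x∈C → slack-tight x∈C (All.lookup small x∈C)

  totalSlack≡0⇒totals-tight : 0 < k → totalSlack ≡ 0 → TotalsTight
  totalSlack≡0⇒totals-tight 0<k totalSlack≡0 =
    totals-tight (All.map (λ slack≡0 → subst (_< k) (sym slack≡0) 0<k) (sum-map-≡0 C totalSlack≡0))

  module _ (2∣q : 2 ∣ suc m) (2∣n : 2 ∣ n) (2∣lam : 2 ∣ lam) where

    length≤totalSlack : length C ≤ totalSlack
    length≤totalSlack = subst (_≤ totalSlack) (sum-map-1 C)
      (sum-map-mono (All.tabulate (slack-positive-if-even 2∣q 2∣n 2∣lam)))

    totalSlack≡length⇒totals-tight : 1 < k → totalSlack ≡ length C → TotalsTight
    totalSlack≡length⇒totals-tight 1<k totalSlack≡|C| =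
      totals-tight (All.map (λ slack≡1 → subst (_< k) (sym slack≡1) 1<k) slack≡1)
      where
      slack≡1 : All (λ x → slack x ≡ 1) C
      slack≡1 = sum-map-tight (All.tabulate (slack-positive-if-even 2∣q 2∣n 2∣lam))
                              (≤-reflexive (trans totalSlack≡|C| (sym (sum-map-1 C))))

lemma1 : (n q lam : ℕ) → 2 < q →
    (C : List (Word n q)) → IsPacking lam C →
    let L = n * (q ∸ 1) * totA C 0 + 2 * (q ∸ 1) * totA C 1 + 2 * totA C 2
        R = length C * ((n + 1) * (q ∸ 1) * lam)
    in (L + length C * (q ∸ 1) ≤ R)
       × (2 ∣ q → 2 ∣ n → 2 ∣ lam → L + length C * q ≤ R)
       × (L + length C * (q ∸ 1) ≡ R →
            (totA C 0 ≡ length C) × (totA C 1 + length C ≡ length C * lam))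
       × (2 ∣ q → 2 ∣ n → 2 ∣ lam → L + length C * q ≡ R →
            (totA C 0 ≡ length C) × (totA C 1 + length C ≡ length C * lam))
lemma1 n (suc (suc (suc r))) lam (s≤s (s≤s (s≤s _))) C packing =
  bound , even-bound , equality-case , even-equality-case
  where
  open Slack {n} {suc r} {lam} {C} packing
  |C| R : ℕ
  |C| = length C
  R = |C| * ((n + 1) * m * lam)

  |C|q≡|C|m+|C| : L + |C| * suc m ≡ L + |C| * m + |C|
  |C|q≡|C|m+|C| = trans (cong (L +_) (trans (*-suc |C| m) (+-comm |C| _))) (sym (+-assoc L _ |C|))

  bound : L + |C| * m ≤ R
  bound = subst (L + |C| * m ≤_) total-balance (m≤m+n _ totalSlack)

  even-bound : 2 ∣ suc m → 2 ∣ n → 2 ∣ lam → L + |C| * suc m ≤ R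
  even-bound 2∣q 2∣n 2∣lam =
    subst₂ _≤_ (sym |C|q≡|C|m+|C|) total-balance (+-monoʳ-≤ _ (length≤totalSlack 2∣q 2∣n 2∣lam))

  equality-case : L + |C| * m ≡ R → TotalsTight
  equality-case eq = totalSlack≡0⇒totals-tight (s≤s z≤n)
    (+-cancelˡ-≡ (L + |C| * m) totalSlack 0 (trans total-balance (trans (sym eq) (sym (+-identityʳ _)))))

  even-equality-case : 2 ∣ suc m → 2 ∣ n → 2 ∣ lam → L + |C| * suc m ≡ R → TotalsTight
  even-equality-case 2∣q 2∣n 2∣lam eq = totalSlack≡length⇒totals-tight 2∣q 2∣n 2∣lam (s≤s (2∣3+r⇒0<r r 2∣q))
    (+-cancelˡ-≡ (L + |C| * m) totalSlack |C| (trans total-balance (trans (sym eq) |C|q≡|C|m+|C|)))
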